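{- For every $n\ge 0$, there is a bijection between the set of unordered binary increasing trees with $n+1$ nodes and the set of t-shelves of size $n$ in which no node that is a left child of its parent has a left child.
   Context: A treeshelf (t-shelf) of size $n\ge 1$ is a rooted binary tree with $n$ nodes labeled bijectively by $\{1,\dots,n\}$ so that labels strictly increase along every path starting at the root, in which every node has at most one left child and at most one right child, and every child (including a child with no sibling) is designated either as the left child or the right child of its parent. There is a unique empty t-shelf, of size $0$. An unordered binary increasing tree with $m$ nodes is a rooted tree with nodes labeled bijectively by $\{1,\dots,m\}$, labels strictly increasing along every path from the root, in which every node has at most two children and children are not ordered (no left/right distinction). -}

module Defs where

open import Data.Nat using (ℕ; zero; suc; _≤_; _≟_)
open import Data.Fin using (Fin; toℕ)
open import Data.Product using (_×_; _,_)
open import Data.List using (List; []; _∷_; _∷ʳ_)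
open import Data.Maybe using (Maybe; just; nothing)
open import Data.Unit using (⊤)
open import Relation.Binary.PropositionalEquality using (_≡_)
open import Relation.Nullary using (yes; no)
open import Data.Bool using (Bool; true; false; _∧_)

-- We use 0-based labels: the node
-- labelled 0 is the root (paper's label 1), node k+1 is the paper's label k+2.
-- An increasing rooted tree on labels {0,…,m} is exactly determined by the
-- parent of each non-root node j ∈ {1,…,m}, which is a node with smaller label.
-- We store these parents as a snoc-list: the entry added at stage k
-- (k = 0,…,m-1) is the parent of node k+1, an element of Fin (suc k).

data Side : Set where
  L R : Side

data UPar : ℕ → Set where
  []  : UPar 0
  _▷_ : ∀ {m} → UPar m → Fin (suc m) → UPar (suc m)

data SPar : ℕ → Set where
  []  : SPar 0
  _▷_ : ∀ {m} → SPar m → Fin (suc m) × Side → SPar (suc m)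

-- list of entries; position k holds the data of node k+1
uList : ∀ {m} → UPar m → List ℕ
uList []      = []
uList (p ▷ x) = uList p ∷ʳ toℕ x

sList : ∀ {m} → SPar m → List (ℕ × Side)
sList []            = []
sList (p ▷ (x , s)) = sList p ∷ʳ (toℕ x , s)

sideEq : Side → Side → Bool
sideEq L L = true
sideEq R R = true
sideEq _ _ = false

natEq : ℕ → ℕ → Bool
natEq a b with a ≟ b
... | yes _ = true
... | no  _ = false

uChildren : ℕ → List ℕ → ℕ
uChildren v []       = 0
uChildren v (x ∷ xs) with natEq v x
... | true  = suc (uChildren v xs)
... | false = uChildren v xs

sChildren : ℕ → Side → List (ℕ × Side) → ℕ
sChildren v s []              = 0
sChildren v s ((x , t) ∷ xs) with natEq v x ∧ sideEq s t
... | true  = suc (sChildren v s xs)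
... | false = sChildren v s xs

entryAt : {A : Set} → List A → ℕ → Maybe A
entryAt []       _       = nothing
entryAt (x ∷ xs) zero    = just x
entryAt (x ∷ xs) (suc k) = entryAt xs k

-- Unordered binary increasing tree with m+1 nodes (labels 0..m):
-- a parent map in which every node has at most two children.
record UBITree (m : ℕ) : Set where
  constructor ubit
  field
    parents    : UPar m
    .atMostTwo : ∀ (v : ℕ) → uChildren v (uList parents) ≤ 2

-- Nonempty t-shelf with m+1 nodes: parent map with sides, every node has at
-- most one left child and at most one right child.
record TShelf⁺ (m : ℕ) : Set where
  constructor tshelf
  field
    parents   : SPar m
    .atMostOne : ∀ (v : ℕ) (s : Side) → sChildren v s (sList parents) ≤ 1

TShelf : ℕ → Set
TShelf zero    = ⊤
TShelf (suc m) = TShelf⁺ m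

NoLeftLeft : (n : ℕ) → TShelf n → Set
NoLeftLeft zero    _ = ⊤
NoLeftLeft (suc m) t =
  ∀ (k p : ℕ) → entryAt (sList (TShelf⁺.parents t)) k ≡ just (p , L) →
    sChildren (suc k) L (sList (TShelf⁺.parents t)) ≡ 0

-- the set of t-shelves of size n with the no-left-left property
-- (the property proof is irrelevant, so equality is equality of shelves)
record NLLShelf (n : ℕ) : Set where
  constructor nll
  field
    shelf : TShelf n
    .prop : NoLeftLeft n shelf

module Submission where

-- Delete the root 0 of the tree and let tree node j+1 become shelf node j.
-- If tree node v has children c₁ < c₂, then in the shelf c₁-1 is the right
-- child of v-1 (for v = 0, c₁ = 1 becomes the shelf root) and c₂-1 is the left
-- child of c₁-1.  A shelf left child is thus always a *second* child in the
-- tree, which is never the first child of anything: this is the no-left-left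
-- property, and conversely the rule can be undone node by node.

open import Defs
open import Data.Bool using (true; false; _∧_)
open import Data.Empty using (⊥-elim)
open import Data.Fin using (Fin; zero; suc; toℕ; fromℕ<)
open import Data.Fin.Properties using (toℕ-fromℕ<; toℕ<n; toℕ-injective)
  renaming (_≟_ to _≟ᶠ_)
open import Data.List using (List; []; _∷_; _++_; length)
open import Data.List.Properties using (length-++)
open import Data.Maybe using (Maybe; just; nothing)
open import Data.Maybe.Properties using (just-injective)
open import Data.Nat using (ℕ; zero; suc; _+_; _∸_; _≤_; _<_; z≤n; s≤s; _≟_; _<?_; _≤?_)
open import Data.Nat.Properties
open import Data.Product using (_×_; _,_; proj₁; proj₂; ∃)
open import Data.Unit using (tt)
open import Function.Bundles using (_⤖_; mk↔ₛ′)
open import Function.Properties.Inverse using (↔⇒⤖)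
open import Relation.Binary.PropositionalEquality
open import Relation.Nullary using (yes; no; Dec)
open import Relation.Nullary.Decidable using (recompute)

-- A natural number as an element of Fin (suc k), truncated to 0 when out of
-- range; on the range {0,…,k} it is an inverse of toℕ.
clamp : ∀ k → ℕ → Fin (suc k)
clamp k n with n <? suc k
... | yes n<1+k = fromℕ< n<1+k
... | no  _     = zero

toℕ-clamp : ∀ k n → n ≤ k → toℕ (clamp k n) ≡ n
toℕ-clamp k n n≤k with n <? suc k
... | yes n<1+k = toℕ-fromℕ< n<1+k
... | no  n≮1+k = ⊥-elim (n≮1+k (s≤s n≤k))

clamp-toℕ : ∀ k (i : Fin (suc k)) → clamp k (toℕ i) ≡ i
clamp-toℕ k i = toℕ-injective (toℕ-clamp k (toℕ i) (≤-pred (toℕ<n i)))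

natEq-≡ : ∀ {a b} → a ≡ b → natEq a b ≡ true
natEq-≡ {a} refl with a ≟ a
... | yes _  = refl
... | no a≢a = ⊥-elim (a≢a refl)

natEq-≢ : ∀ {a b} → a ≢ b → natEq a b ≡ false
natEq-≢ {a} {b} a≢b with a ≟ b
... | yes a≡b = ⊥-elim (a≢b a≡b)
... | no  _   = refl

sideEq-refl : ∀ s → sideEq s s ≡ true
sideEq-refl L = refl
sideEq-refl R = refl

sideEq-≢ : ∀ {s t} → s ≢ t → sideEq s t ≡ false
sideEq-≢ {L} {L} s≢t = ⊥-elim (s≢t refl)
sideEq-≢ {L} {R} _   = refl
sideEq-≢ {R} {L} _   = refl
sideEq-≢ {R} {R} s≢t = ⊥-elim (s≢t refl)

uChildren-++ : ∀ v xs ys → uChildren v (xs ++ ys) ≡ uChildren v xs + uChildren v ys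
uChildren-++ v []       ys = refl
uChildren-++ v (x ∷ xs) ys with natEq v x
... | true  = cong suc (uChildren-++ v xs ys)
... | false = uChildren-++ v xs ys

sChildren-++ : ∀ v s xs ys → sChildren v s (xs ++ ys) ≡ sChildren v s xs + sChildren v s ys
sChildren-++ v s []             ys = refl
sChildren-++ v s ((x , t) ∷ xs) ys with natEq v x ∧ sideEq s t
... | true  = cong suc (sChildren-++ v s xs ys)
... | false = sChildren-++ v s xs ys

childCount : ∀ {m} → UPar m → ℕ → ℕ
childCount p v = uChildren v (uList p)

childCount-hit : ∀ {m} (p : UPar m) x v → toℕ x ≡ v → childCount (p ▷ x) v ≡ suc (childCount p v)
childCount-hit p x v x≡v
  rewrite uChildren-++ v (uList p) (toℕ x ∷ []) | natEq-≡ (sym x≡v) = +-comm (childCount p v) 1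

childCount-miss : ∀ {m} (p : UPar m) x v → toℕ x ≢ v → childCount (p ▷ x) v ≡ childCount p v
childCount-miss p x v x≢v
  rewrite uChildren-++ v (uList p) (toℕ x ∷ []) | natEq-≢ (λ v≡x → x≢v (sym v≡x)) = +-identityʳ (childCount p v)

childCount-mono : ∀ {m} (p : UPar m) x v → childCount p v ≤ childCount (p ▷ x) v
childCount-mono p x v rewrite uChildren-++ v (uList p) (toℕ x ∷ []) = m≤m+n _ _

slotCount : ∀ {m} → SPar m → ℕ → Side → ℕ
slotCount q v s = sChildren v s (sList q)

slotCount-hit : ∀ {m} (q : SPar m) y s v → toℕ y ≡ v → slotCount (q ▷ (y , s)) v s ≡ suc (slotCount q v s)
slotCount-hit q y s v refl
  rewrite sChildren-++ (toℕ y) s (sList q) ((toℕ y , s) ∷ []) | natEq-≡ {toℕ y} refl | sideEq-refl s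
  = +-comm (slotCount q (toℕ y) s) 1

slotCount-otherParent : ∀ {m} (q : SPar m) y t v s → toℕ y ≢ v → slotCount (q ▷ (y , t)) v s ≡ slotCount q v s
slotCount-otherParent q y t v s y≢v
  rewrite sChildren-++ v s (sList q) ((toℕ y , t) ∷ []) | natEq-≢ (λ v≡y → y≢v (sym v≡y))
  = +-identityʳ (slotCount q v s)

slotCount-otherSide : ∀ {m} (q : SPar m) y t v s → t ≢ s → slotCount (q ▷ (y , t)) v s ≡ slotCount q v s
slotCount-otherSide q y t v s t≢s
  rewrite sChildren-++ v s (sList q) ((toℕ y , t) ∷ []) | sideEq-≢ (λ s≡t → t≢s (sym s≡t))
  with natEq v (toℕ y)
... | true  = +-identityʳ (slotCount q v s)
... | false = +-identityʳ (slotCount q v s)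

slotCount-mono : ∀ {m} (q : SPar m) e v s → slotCount q v s ≤ slotCount (q ▷ e) v s
slotCount-mono q (y , t) v s rewrite sChildren-++ v s (sList q) ((toℕ y , t) ∷ []) = m≤m+n _ _

-- Parents precede their children, so nodes m, m+1, … have no children yet.
slotCount-beyond : ∀ {m} (q : SPar m) w s → m ≤ w → slotCount q w s ≡ 0
slotCount-beyond []                  w s _   = refl
slotCount-beyond {suc m} (q ▷ (y , t)) w s m<w =
  trans (slotCount-otherParent q y t w s (<⇒≢ (<-≤-trans (toℕ<n y) m<w)))
        (slotCount-beyond q w s (≤-trans (n≤1+n m) m<w))

-- The k-th entry of a sided parent sequence records the parent and side of
-- node k+1.
entry : ∀ {m} → SPar m → ℕ → Maybe (ℕ × Side)
entry q k = entryAt (sList q) k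

length-sList : ∀ {m} (q : SPar m) → length (sList q) ≡ m
length-sList []            = refl
length-sList (q ▷ (y , s))
  rewrite length-++ (sList q) {(toℕ y , s) ∷ []} | length-sList q = +-comm _ 1

entryAt-last : ∀ {A : Set} (xs : List A) x → entryAt (xs ++ x ∷ []) (length xs) ≡ just x
entryAt-last []       x = refl
entryAt-last (_ ∷ xs) x = entryAt-last xs x

entryAt-init : ∀ {A : Set} (xs : List A) x k → k ≢ length xs → entryAt (xs ++ x ∷ []) k ≡ entryAt xs k
entryAt-init []       x zero    k≢0 = ⊥-elim (k≢0 refl)
entryAt-init []       x (suc k) _   = refl
entryAt-init (_ ∷ xs) x zero    _   = refl
entryAt-init (_ ∷ xs) x (suc k) k≢n = entryAt-init xs x k (λ k≡n → k≢n (cong suc k≡n))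

entryAt-beyond : ∀ {A : Set} (xs : List A) k → length xs ≤ k → entryAt xs k ≡ nothing
entryAt-beyond []       k       _         = refl
entryAt-beyond (_ ∷ xs) (suc k) (s≤s n≤k) = entryAt-beyond xs k n≤k

entry-last : ∀ {m} (q : SPar m) y s → entry (q ▷ (y , s)) m ≡ just (toℕ y , s)
entry-last q y s =
  subst (λ k → entryAt (sList q ++ (toℕ y , s) ∷ []) k ≡ just (toℕ y , s))
        (length-sList q) (entryAt-last (sList q) (toℕ y , s))

entry-init : ∀ {m} (q : SPar m) e k → k ≢ m → entry (q ▷ e) k ≡ entry q k
entry-init q (y , s) k k≢m = entryAt-init (sList q) _ k (λ k≡n → k≢m (trans k≡n (length-sList q)))

entry-< : ∀ {m} (q : SPar m) k e → entry q k ≡ just e → k < m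
entry-< {m} q k e eq with m ≤? k
... | no  m≰k = ≰⇒> m≰k
... | yes m≤k with trans (sym eq) (entryAt-beyond (sList q) k (subst (_≤ k) (sym (length-sList q)) m≤k))
...   | ()

entry-exists : ∀ {m} (q : SPar m) k → k < m → ∃ λ e → entry q k ≡ just e
entry-exists []                     k ()
entry-exists (_▷_ {m} q (y , s)) k k<1+m with k ≟ m
... | yes refl = _ , entry-last q y s
... | no  k≢m with entry-exists q k (≤∧≢⇒< (≤-pred k<1+m) k≢m)
...   | e , eq = e , trans (entry-init q _ k k≢m) eq

-- Children are referred to by
-- their shelf label: c stands for tree node c+1.  firstChild p v is the
-- smallest child of v, and parentOf p c is the parent of tree node c+1.
-- Both are computed by scanning the parent sequence; the step functions take
-- the comparison of the newly added node as an argument so that they compute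
-- by cases on that comparison.

firstChildStep : ∀ {a b : ℕ} → ℕ → Maybe ℕ → Dec (a ≡ b) → Maybe ℕ
firstChildStep m (just c) _       = just c
firstChildStep m nothing  (yes _) = just m
firstChildStep m nothing  (no _)  = nothing

firstChild : ∀ {m} → UPar m → ℕ → Maybe ℕ
firstChild []            v = nothing
firstChild (_▷_ {m} p x) v = firstChildStep m (firstChild p v) (toℕ x ≟ v)

firstChildStep-≢ : ∀ {a b : ℕ} m r (d : Dec (a ≡ b)) → a ≢ b → firstChildStep m r d ≡ r
firstChildStep-≢ m (just _) d       _   = refl
firstChildStep-≢ m nothing  (yes a≡b) a≢b = ⊥-elim (a≢b a≡b)
firstChildStep-≢ m nothing  (no _)  _   = refl

firstChildStep-≡ : ∀ {a b : ℕ} m (d : Dec (a ≡ b)) → a ≡ b → firstChildStep m nothing d ≡ just m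
firstChildStep-≡ m (yes _)   _   = refl
firstChildStep-≡ m (no a≢b) a≡b = ⊥-elim (a≢b a≡b)

parentStep : ∀ {a b : ℕ} → Dec (a ≡ b) → ℕ → ℕ → ℕ
parentStep (yes _) new old = new
parentStep (no _)  new old = old

parentOf : ∀ {m} → UPar m → ℕ → ℕ
parentOf []            c = 0
parentOf (_▷_ {m} p x) c = parentStep (c ≟ m) (toℕ x) (parentOf p c)

parentStep-≡ : ∀ {a b : ℕ} (d : Dec (a ≡ b)) new old → a ≡ b → parentStep d new old ≡ new
parentStep-≡ (yes _)   _ _ _   = refl
parentStep-≡ (no a≢b) _ _ a≡b = ⊥-elim (a≢b a≡b)

parentStep-≢ : ∀ {a b : ℕ} (d : Dec (a ≡ b)) new old → a ≢ b → parentStep d new old ≡ old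
parentStep-≢ (yes a≡b) _ _ a≢b = ⊥-elim (a≢b a≡b)
parentStep-≢ (no _)    _ _ _   = refl

firstChild-< : ∀ {m} (p : UPar m) v c → firstChild p v ≡ just c → c < m
firstChild-< []            v c ()
firstChild-< (_▷_ {m} p x) v c eq with firstChild p v in fc
... | just c′ = subst (_< suc m) (just-injective eq) (m<n⇒m<1+n (firstChild-< p v c′ fc))
... | nothing with toℕ x ≟ v
...   | yes _ = subst (_< suc m) (just-injective eq) (n<1+n m)
...   | no  _ with eq
...     | ()

toℕ-clamp-firstChild : ∀ {m} (p : UPar (suc m)) v c → firstChild p v ≡ just c → toℕ (clamp m c) ≡ c
toℕ-clamp-firstChild {m} p v c fc = toℕ-clamp m c (≤-pred (firstChild-< p v c fc))

firstChild-nothing : ∀ {m} (p : UPar m) v → firstChild p v ≡ nothing → childCount p v ≡ 0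
firstChild-nothing []            v _  = refl
firstChild-nothing (_▷_ {m} p x) v eq with firstChild p v in fc
... | just _ with eq
...   | ()
firstChild-nothing (_▷_ {m} p x) v eq | nothing with toℕ x ≟ v
...   | yes _ with eq
...     | ()
firstChild-nothing (_▷_ {m} p x) v eq | nothing | no x≢v =
  trans (childCount-miss p x v x≢v) (firstChild-nothing p v fc)

parentOf-firstChild : ∀ {m} (p : UPar m) v c → firstChild p v ≡ just c → parentOf p c ≡ v
parentOf-firstChild []            v c ()
parentOf-firstChild (_▷_ {m} p x) v c eq with firstChild p v in fc
... | just c′ rewrite just-injective (sym eq) with c′ ≟ m
...   | yes c′≡m = ⊥-elim (<⇒≢ (firstChild-< p v c′ fc) c′≡m)
...   | no  _    = parentOf-firstChild p v c′ fc
parentOf-firstChild (_▷_ {m} p x) v c eq | nothing with toℕ x ≟ v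
...   | yes x≡v rewrite just-injective (sym eq) = trans (parentStep-≡ (m ≟ m) (toℕ x) _ refl) x≡v
parentOf-firstChild (_▷_ {m} p x) v c eq | nothing | no _ with eq
...   | ()

firstChild-root : ∀ {m} (p : UPar (suc m)) → firstChild p 0 ≡ just 0
firstChild-root {zero}  ([] ▷ zero) = refl
firstChild-root {suc m} (p ▷ x) rewrite firstChild-root p = refl

parentOf-0 : ∀ {m} (p : UPar (suc m)) → parentOf p 0 ≡ 0
parentOf-0 {zero}  ([] ▷ zero) = refl
parentOf-0 {suc m} (p ▷ x)     = trans (parentStep-≢ (0 ≟ suc m) (toℕ x) _ (λ ())) (parentOf-0 p)

parentOf-≤ : ∀ {m} (p : UPar m) c → parentOf p c ≤ m
parentOf-≤ []            c = z≤n
parentOf-≤ (_▷_ {m} p x) c with c ≟ m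
... | yes _ = ≤-trans (≤-pred (toℕ<n x)) (n≤1+n m)
... | no  _ = ≤-trans (parentOf-≤ p c) (n≤1+n m)

-- The two maps.  When tree node m+2 is attached to tree node x, the new shelf
-- node m+1 becomes the right child of x-1 if x had no child so far, and the
-- left child of x's first child otherwise.
newSlot : ∀ m → (x : ℕ) → (firstChildOfx : Maybe ℕ) → Fin (suc m) × Side
newSlot m x nothing  = clamp m (x ∸ 1) , R
newSlot m x (just c) = clamp m c , L

toShelf : ∀ {m} → UPar (suc m) → SPar m
toShelf {zero}  _       = []
toShelf {suc m} (p ▷ x) = toShelf p ▷ newSlot m (toℕ x) (firstChild p (toℕ x))

-- Conversely, a right child y+1 becomes a child of tree node y+1 and a left
-- child of y becomes a sibling of tree node y+1.
fromShelf : ∀ {m} → SPar m → UPar (suc m)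
fromShelf []                  = [] ▷ zero
fromShelf (q ▷ (y , R))      = fromShelf q ▷ suc y
fromShelf (_▷_ {m} q (y , L)) = fromShelf q ▷ clamp (suc m) (parentOf (fromShelf q) (toℕ y))

fromShelf-toShelf : ∀ {m} (p : UPar (suc m)) → fromShelf (toShelf p) ≡ p
fromShelf-toShelf {zero}  ([] ▷ zero) = refl
fromShelf-toShelf {suc m} (p ▷ x) with firstChild p (toℕ x) in fc
fromShelf-toShelf {suc m} (p ▷ zero) | nothing with trans (sym fc) (firstChild-root p)
... | ()
fromShelf-toShelf {suc m} (p ▷ suc x) | nothing
  rewrite fromShelf-toShelf p | clamp-toℕ m x = refl
fromShelf-toShelf {suc m} (p ▷ x) | just c
  rewrite fromShelf-toShelf p | toℕ-clamp-firstChild p (toℕ x) c fc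
        | parentOf-firstChild p (toℕ x) c fc = cong (p ▷_) (clamp-toℕ (suc m) x)

occupied : Maybe ℕ → ℕ
occupied nothing  = 0
occupied (just _) = 1

rightSlot-toShelf : ∀ {m} (p : UPar (suc m)) y → slotCount (toShelf p) y R ≡ occupied (firstChild p (suc y))
rightSlot-toShelf {zero}  ([] ▷ zero) y = refl
rightSlot-toShelf {suc m} (p ▷ x) y with firstChild p (toℕ x) in fc
rightSlot-toShelf {suc m} (p ▷ zero) y | nothing with trans (sym fc) (firstChild-root p)
... | ()
rightSlot-toShelf {suc m} (p ▷ suc x) y | nothing rewrite clamp-toℕ m x with toℕ x ≟ y
... | yes refl
  rewrite slotCount-hit (toShelf p) x R (toℕ x) refl | rightSlot-toShelf p (toℕ x) | fc
        | firstChildStep-≡ (suc m) (suc (toℕ x) ≟ suc (toℕ x)) refl = refl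
... | no x≢y
  rewrite slotCount-otherParent (toShelf p) x R y R x≢y | rightSlot-toShelf p y
        | firstChildStep-≢ (suc m) (firstChild p (suc y)) (suc (toℕ x) ≟ suc y) (λ eq → x≢y (suc-injective eq))
  = refl
rightSlot-toShelf {suc m} (p ▷ x) y | just c
  rewrite slotCount-otherSide (toShelf p) (clamp m c) L y R (λ ()) | rightSlot-toShelf p y
  with toℕ x ≟ suc y
... | yes x≡1+y rewrite subst (λ z → firstChild p z ≡ just c) x≡1+y fc = refl
... | no  x≢1+y = sym (cong occupied (firstChildStep-≢ (suc m) (firstChild p (suc y)) (no x≢1+y) x≢1+y))

leftSlot-toShelf : ∀ {m} (p : UPar (suc m)) v c → firstChild p v ≡ just c →
                   suc (slotCount (toShelf p) c L) ≡ childCount p v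
leftSlot-toShelf {zero} ([] ▷ zero) v c eq with 0 ≟ v
... | yes refl with eq
...   | refl = refl
leftSlot-toShelf {zero} ([] ▷ zero) v c () | no _
leftSlot-toShelf {suc m} (p ▷ x) v c eq with firstChild p v in fcv
leftSlot-toShelf {suc m} (p ▷ x) v c refl | just c with toℕ x ≟ v
... | yes x≡v
  rewrite subst (λ z → firstChild p z ≡ just c) (sym x≡v) fcv
        | slotCount-hit (toShelf p) (clamp m c) L c (toℕ-clamp-firstChild p v c fcv)
        | childCount-hit p x v x≡v | leftSlot-toShelf p v c fcv = refl
... | no x≢v with firstChild p (toℕ x) in fcx
...   | nothing
  rewrite slotCount-otherSide (toShelf p) (clamp m (toℕ x ∸ 1)) R c L (λ ()) | childCount-miss p x v x≢v
  = leftSlot-toShelf p v c fcv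
...   | just c′ with toℕ (clamp m c′) ≟ c
...     | no c′≢c
  rewrite slotCount-otherParent (toShelf p) (clamp m c′) L c L c′≢c | childCount-miss p x v x≢v
  = leftSlot-toShelf p v c fcv
...     | yes c′≡c = ⊥-elim (x≢v (begin
    toℕ x             ≡⟨ parentOf-firstChild p (toℕ x) c′ fcx ⟨
    parentOf p c′     ≡⟨ cong (parentOf p) (trans (sym (toℕ-clamp-firstChild p _ c′ fcx)) c′≡c) ⟩
    parentOf p c      ≡⟨ parentOf-firstChild p v c fcv ⟩
    v                 ∎))
  where open ≡-Reasoning
leftSlot-toShelf {suc m} (p ▷ x) v c eq | nothing with toℕ x ≟ v
leftSlot-toShelf {suc m} (p ▷ x) v c refl | nothing | yes x≡v
  rewrite subst (λ z → firstChild p z ≡ nothing) (sym x≡v) fcv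
        | slotCount-otherSide (toShelf p) (clamp m (toℕ x ∸ 1)) R (suc m) L (λ ())
        | slotCount-beyond (toShelf p) (suc m) L (n≤1+n m)
        | childCount-hit p x v x≡v | firstChild-nothing p v fcv = refl
leftSlot-toShelf {suc m} (p ▷ x) v c () | nothing | no _

rightEntry-toShelf : ∀ {m} (p : UPar (suc m)) k z → entry (toShelf p) k ≡ just (z , R) →
                     parentOf p (suc k) ≡ suc z × firstChild p (suc z) ≡ just (suc k)
rightEntry-toShelf {zero}  ([] ▷ zero) k z ()
rightEntry-toShelf {suc m} (p ▷ x) k z eq with k ≟ m
... | no k≢m with rightEntry-toShelf p k z (trans (sym (entry-init (toShelf p) _ k k≢m)) eq)
...   | parent≡ , first≡ =
  trans (parentStep-≢ (suc k ≟ suc m) _ _ (λ eq → k≢m (suc-injective eq))) parent≡ ,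
  cong (λ r → firstChildStep (suc m) r (toℕ x ≟ suc z)) first≡
rightEntry-toShelf {suc m} (p ▷ x) k z eq | yes refl
  with firstChild p (toℕ x) in fc | trans (sym (entry-last (toShelf p) _ _)) eq
rightEntry-toShelf {suc m} (p ▷ zero) k z eq | yes refl | nothing | _
  with trans (sym fc) (firstChild-root p)
... | ()
rightEntry-toShelf {suc m} (p ▷ suc x) k z eq | yes refl | nothing | last≡
  with cong proj₁ (just-injective last≡)
... | x≡z rewrite clamp-toℕ m x | sym x≡z | fc =
  parentStep-≡ (suc m ≟ suc m) _ _ refl ,
  firstChildStep-≡ (suc m) (suc (toℕ x) ≟ suc (toℕ x)) refl
rightEntry-toShelf {suc m} (p ▷ x) k z eq | yes refl | just c | last≡
  with cong proj₂ (just-injective last≡)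
... | ()

leftEntry-toShelf : ∀ {m} (p : UPar (suc m)) k w → entry (toShelf p) k ≡ just (w , L) →
                    ∀ v → firstChild p v ≢ just (suc k)
leftEntry-toShelf {zero}  ([] ▷ zero) k w () v
leftEntry-toShelf {suc m} (p ▷ x) k w eq v fcv with k ≟ m
... | no k≢m with leftEntry-toShelf p k w (trans (sym (entry-init (toShelf p) _ k k≢m)) eq) v
...   | notFirst with firstChild p v | toℕ x ≟ v
...     | just _  | _     = notFirst fcv
...     | nothing | yes _ = k≢m (sym (suc-injective (just-injective fcv)))
...     | nothing | no _  with fcv
...       | ()
leftEntry-toShelf {suc m} (p ▷ x) k w eq v fcv | yes refl
  with firstChild p (toℕ x) in fcx | trans (sym (entry-last (toShelf p) _ _)) eq
... | nothing | last≡ with cong proj₂ (just-injective last≡)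
...   | ()
leftEntry-toShelf {suc m} (p ▷ x) k w eq v fcv | yes refl | just _ | _
  with firstChild p v in fc | toℕ x ≟ v
... | just c  | _     = <⇒≢ (firstChild-< p v c fc) (just-injective fcv)
... | nothing | yes x≡v with trans (sym fcx) (subst (λ z → firstChild p z ≡ nothing) (sym x≡v) fc)
...   | ()
leftEntry-toShelf {suc m} (p ▷ x) k w eq v () | yes refl | just _ | _ | nothing | no _

AtMostOne : ∀ {m} → SPar m → Set
AtMostOne q = ∀ v s → slotCount q v s ≤ 1

LeftLeftFree : ∀ {m} → SPar m → Set
LeftLeftFree q = ∀ k w → entry q k ≡ just (w , L) → slotCount q (suc k) L ≡ 0

toShelf-noLeftLeft : ∀ {m} (p : UPar (suc m)) → LeftLeftFree (toShelf p)
toShelf-noLeftLeft {zero}  ([] ▷ zero) k w ()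
toShelf-noLeftLeft {suc m} (p ▷ x) k w eq with k ≟ m
... | yes refl =
  trans (slotCount-otherParent (toShelf p) _ _ (suc k) L (<⇒≢ (toℕ<n (proj₁ (newSlot k (toℕ x) (firstChild p (toℕ x)))))))
        (slotCount-beyond (toShelf p) (suc k) L (n≤1+n k))
... | no k≢m with toShelf-noLeftLeft p k w (trans (sym (entry-init (toShelf p) _ k k≢m)) eq)
...   | noLeft with firstChild p (toℕ x) in fcx
...     | nothing = trans (slotCount-otherSide (toShelf p) _ R (suc k) L (λ ())) noLeft
...     | just c with toℕ (clamp m c) ≟ suc k
...       | no  c≢1+k = trans (slotCount-otherParent (toShelf p) _ L (suc k) L c≢1+k) noLeft
...       | yes c≡1+k = ⊥-elim (leftEntry-toShelf p k w (trans (sym (entry-init (toShelf p) _ k k≢m)) eq) (toℕ x)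
                          (trans fcx (cong just (trans (sym (toℕ-clamp-firstChild p _ c fcx)) c≡1+k))))

toShelf-atMostOne : ∀ {m} (p : UPar (suc m)) → (∀ v → childCount p v ≤ 2) → AtMostOne (toShelf p)
toShelf-atMostOne p _ v R rewrite rightSlot-toShelf p v with firstChild p (suc v)
... | nothing = z≤n
... | just _  = s≤s z≤n
toShelf-atMostOne {zero}  ([] ▷ zero) _ v L = z≤n
toShelf-atMostOne {suc m} (p ▷ x) atMostTwo v L
  with toShelf-atMostOne p (λ u → ≤-trans (childCount-mono p x u) (atMostTwo u)) v L
... | ih with firstChild p (toℕ x) in fcx
... | nothing = subst (_≤ 1) (sym (slotCount-otherSide (toShelf p) _ R v L (λ ()))) ih
... | just c with toℕ (clamp m c) ≟ v
...   | no  c≢v = subst (_≤ 1) (sym (slotCount-otherParent (toShelf p) _ L v L c≢v)) ih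
...   | yes c≡v = subst (_≤ 1) (sym (slotCount-hit (toShelf p) _ L v c≡v)) noOtherSibling
  where
    c≡v′ : c ≡ v
    c≡v′ = trans (sym (toℕ-clamp-firstChild p _ c fcx)) c≡v
    -- x already has its first child c and gains another, so c had no left child yet
    noOtherSibling : suc (slotCount (toShelf p) v L) ≤ 1
    noOtherSibling = subst (λ u → suc (slotCount (toShelf p) u L) ≤ 1) c≡v′
      (subst (_≤ 1) (sym (leftSlot-toShelf p (toℕ x) c fcx))
        (≤-pred (subst (_≤ 2) (childCount-hit p x (toℕ x) refl) (atMostTwo (toℕ x)))))

AtMostOne-init : ∀ {m} (q : SPar m) e → AtMostOne (q ▷ e) → AtMostOne q
AtMostOne-init q e atMostOne v s = ≤-trans (slotCount-mono q e v s) (atMostOne v s)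

LeftLeftFree-init : ∀ {m} (q : SPar m) e → LeftLeftFree (q ▷ e) → LeftLeftFree q
LeftLeftFree-init q e leftLeftFree k w eq =
  n≤0⇒n≡0 (≤-trans (slotCount-mono q e (suc k) L)
    (≤-reflexive (leftLeftFree k w (trans (entry-init q e k (<⇒≢ (entry-< q k _ eq))) eq))))

lastSlot-free : ∀ {m} (q : SPar m) y s → AtMostOne (q ▷ (y , s)) → slotCount q (toℕ y) s ≡ 0
lastSlot-free q y s atMostOne =
  n≤0⇒n≡0 (≤-pred (subst (_≤ 1) (slotCount-hit q y s (toℕ y) refl) (atMostOne (toℕ y) s)))

occupied-0 : ∀ r → occupied r ≡ 0 → r ≡ nothing
occupied-0 nothing  _ = refl
occupied-0 (just _) ()

-- Let q be a shelf for which toShelf (fromShelf q) ≡ q.  Appending a right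
-- child to y attaches a first child to tree node y+1 …
fromShelf-right : ∀ {m} (q : SPar m) y → toShelf (fromShelf q) ≡ q → AtMostOne (q ▷ (y , R)) →
                  firstChild (fromShelf q) (suc (toℕ y)) ≡ nothing
fromShelf-right q y roundTrip atMostOne = occupied-0 _ (begin
  occupied (firstChild (fromShelf q) (suc (toℕ y))) ≡⟨ rightSlot-toShelf (fromShelf q) (toℕ y) ⟨
  slotCount (toShelf (fromShelf q)) (toℕ y) R       ≡⟨ cong (λ r → slotCount r (toℕ y) R) roundTrip ⟩
  slotCount q (toℕ y) R                             ≡⟨ lastSlot-free q y R atMostOne ⟩
  0                                                 ∎)
  where open ≡-Reasoning

-- … and appending a left child to y attaches a second child to the parent
-- of tree node y+1, whose first child is y+1 because y is not a left child.
fromShelf-left : ∀ {m} (q : SPar m) y → toShelf (fromShelf q) ≡ q →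
                 AtMostOne (q ▷ (y , L)) → LeftLeftFree (q ▷ (y , L)) →
                 firstChild (fromShelf q) (parentOf (fromShelf q) (toℕ y)) ≡ just (toℕ y)
fromShelf-left q zero roundTrip _ _ rewrite parentOf-0 (fromShelf q) = firstChild-root (fromShelf q)
fromShelf-left q (suc y) roundTrip atMostOne leftLeftFree with entry-exists q (toℕ y) (toℕ<n y)
... | (z , R) , eq with rightEntry-toShelf (fromShelf q) (toℕ y) z (trans (cong (λ r → entry r (toℕ y)) roundTrip) eq)
...   | parent≡ , first≡ rewrite parent≡ = first≡
fromShelf-left q (suc y) roundTrip atMostOne leftLeftFree | (z , L) , eq
  with trans (sym (slotCount-hit q (suc y) L _ refl))
             (leftLeftFree (toℕ y) z (trans (entry-init q _ (toℕ y) (<⇒≢ (toℕ<n y))) eq))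
... | ()

toShelf-fromShelf : ∀ {m} (q : SPar m) → AtMostOne q → LeftLeftFree q → toShelf (fromShelf q) ≡ q
toShelf-fromShelf [] _ _ = refl
toShelf-fromShelf (_▷_ {m} q (y , R)) atMostOne leftLeftFree
  with toShelf-fromShelf q (AtMostOne-init q _ atMostOne) (LeftLeftFree-init q _ leftLeftFree)
... | roundTrip rewrite fromShelf-right q y roundTrip atMostOne | clamp-toℕ m y | roundTrip = refl
toShelf-fromShelf (_▷_ {m} q (y , L)) atMostOne leftLeftFree
  with toShelf-fromShelf q (AtMostOne-init q _ atMostOne) (LeftLeftFree-init q _ leftLeftFree)
... | roundTrip
  rewrite toℕ-clamp (suc m) (parentOf (fromShelf q) (toℕ y)) (parentOf-≤ (fromShelf q) _)
        | fromShelf-left q y roundTrip atMostOne leftLeftFree | clamp-toℕ m y | roundTrip = refl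

atMostTwo-step : ∀ {m} (p : UPar m) x → (∀ v → childCount p v ≤ 2) → childCount p (toℕ x) ≤ 1 →
                 ∀ v → childCount (p ▷ x) v ≤ 2
atMostTwo-step p x atMostTwo x≤1 v with toℕ x ≟ v
... | yes refl = subst (_≤ 2) (sym (childCount-hit p x _ refl)) (s≤s x≤1)
... | no  x≢v  = subst (_≤ 2) (sym (childCount-miss p x v x≢v)) (atMostTwo v)

-- fromShelf produces binary trees from shelves with both properties: the new
-- node is attached either to a childless node or to a node with one child.
fromShelf-atMostTwo : ∀ {m} (q : SPar m) → AtMostOne q → LeftLeftFree q → ∀ v → childCount (fromShelf q) v ≤ 2
fromShelf-atMostTwo [] _ _ = atMostTwo-step [] zero (λ _ → z≤n) z≤n
fromShelf-atMostTwo (q ▷ (y , R)) atMostOne leftLeftFree =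
  atMostTwo-step (fromShelf q) (suc y) (fromShelf-atMostTwo q atMostOne′ leftLeftFree′)
    (subst (_≤ 1) (sym childless) z≤n)
  where
    atMostOne′ : AtMostOne q
    atMostOne′ = AtMostOne-init q _ atMostOne
    leftLeftFree′ : LeftLeftFree q
    leftLeftFree′ = LeftLeftFree-init q _ leftLeftFree
    childless : childCount (fromShelf q) (suc (toℕ y)) ≡ 0
    childless = firstChild-nothing (fromShelf q) _
      (fromShelf-right q y (toShelf-fromShelf q atMostOne′ leftLeftFree′) atMostOne)
fromShelf-atMostTwo (_▷_ {m} q (y , L)) atMostOne leftLeftFree =
  atMostTwo-step (fromShelf q) (clamp (suc m) u) (fromShelf-atMostTwo q atMostOne′ leftLeftFree′)
    (≤-reflexive oneChild)
  where
    open ≡-Reasoning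
    atMostOne′ : AtMostOne q
    atMostOne′ = AtMostOne-init q _ atMostOne
    leftLeftFree′ : LeftLeftFree q
    leftLeftFree′ = LeftLeftFree-init q _ leftLeftFree
    roundTrip : toShelf (fromShelf q) ≡ q
    roundTrip = toShelf-fromShelf q atMostOne′ leftLeftFree′
    u : ℕ
    u = parentOf (fromShelf q) (toℕ y)
    oneChild : childCount (fromShelf q) (toℕ (clamp (suc m) u)) ≡ 1
    oneChild = begin
      childCount (fromShelf q) (toℕ (clamp (suc m) u))
        ≡⟨ cong (childCount (fromShelf q)) (toℕ-clamp (suc m) u (parentOf-≤ (fromShelf q) _)) ⟩
      childCount (fromShelf q) u
        ≡⟨ leftSlot-toShelf (fromShelf q) u (toℕ y) (fromShelf-left q y roundTrip atMostOne leftLeftFree) ⟨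
      suc (slotCount (toShelf (fromShelf q)) (toℕ y) L)
        ≡⟨ cong (λ r → suc (slotCount r (toℕ y) L)) roundTrip ⟩
      suc (slotCount q (toℕ y) L)
        ≡⟨ cong suc (lastSlot-free q y L atMostOne) ⟩
      1 ∎

-- Equality of sided parent sequences is decidable; this lets us recover the
-- round-trip equation from the irrelevant shelf properties.
_≟ˢ_ : (s t : Side) → Dec (s ≡ t)
L ≟ˢ L = yes refl
L ≟ˢ R = no (λ ())
R ≟ˢ L = no (λ ())
R ≟ˢ R = yes refl

_≟ᵖ_ : ∀ {m} (q q′ : SPar m) → Dec (q ≡ q′)
[] ≟ᵖ [] = yes refl
(q ▷ (y , s)) ≟ᵖ (q′ ▷ (y′ , s′)) with q ≟ᵖ q′ | y ≟ᶠ y′ | s ≟ˢ s′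
... | yes refl | yes refl | yes refl = yes refl
... | no  q≢q′ | _        | _        = no (λ { refl → q≢q′ refl })
... | yes _    | no  y≢y′ | _        = no (λ { refl → y≢y′ refl })
... | yes _    | yes _    | no  s≢s′ = no (λ { refl → s≢s′ refl })

toNLL : ∀ {n} → UBITree n → NLLShelf n
toNLL {zero}  _              = nll tt tt
toNLL {suc m} (ubit p atMostTwo) = nll (tshelf (toShelf p) (toShelf-atMostOne p atMostTwo)) (toShelf-noLeftLeft p)

fromNLL : ∀ {n} → NLLShelf n → UBITree n
fromNLL {zero}  _                                   = ubit [] (λ _ → z≤n)
fromNLL {suc m} (nll (tshelf q atMostOne) leftLeftFree) = ubit (fromShelf q) (fromShelf-atMostTwo q atMostOne leftLeftFree)

ubit-cong : ∀ {m} {p p′ : UPar m} .{a a′} → p ≡ p′ → ubit p a ≡ ubit p′ a′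
ubit-cong refl = refl

nll-cong : ∀ {m} {q q′ : SPar m} .{a a′ b b′} → q ≡ q′ → nll {suc m} (tshelf q a) b ≡ nll (tshelf q′ a′) b′
nll-cong refl = refl

fromNLL-toNLL : ∀ {n} (t : UBITree n) → fromNLL (toNLL t) ≡ t
fromNLL-toNLL {zero}  (ubit [] _) = refl
fromNLL-toNLL {suc m} (ubit p _)  = ubit-cong (fromShelf-toShelf p)

toNLL-fromNLL : ∀ {n} (s : NLLShelf n) → toNLL (fromNLL s) ≡ s
toNLL-fromNLL {zero}  (nll tt _)                               = refl
toNLL-fromNLL {suc m} (nll (tshelf q atMostOne) leftLeftFree) =
  nll-cong (recompute (toShelf (fromShelf q) ≟ᵖ q) (toShelf-fromShelf q atMostOne leftLeftFree))

theorem12 : (n : ℕ) → UBITree n ⤖ NLLShelf n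
theorem12 n = ↔⇒⤖ (mk↔ₛ′ toNLL fromNLL toNLL-fromNLL fromNLL-toNLL)
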